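{- Let $k\ge2$ be an integer and consider the one-dimensional update family consisting of the rules $U_1=\{k,k-1\}$ and $U_2=\{ -k,-k+1\}$. Then there is no $Z\subset\mathbb{Z}$ with $|Z|<k$ such that $|[Z]|=\infty$.
   Context: For a finite family $\mathcal{U}$ of finite subsets of $\mathbb{Z}\setminus\{0\}$ and $A\subseteq\mathbb{Z}$, set $A_0=A$, $A_{t+1}=A_t\cup\{x\in\mathbb{Z}:\exists U\in\mathcal{U},\ x+U\subseteq A_t\}$, and let $[A]=\bigcup_{t\ge0}A_t$. -}

module Defs where

open import Data.Nat using (ℕ; zero; suc)
open import Data.Integer using (ℤ; _+_; _-_; -_; +_)
open import Data.List using (List; []; _∷_)
open import Data.List.Membership.Propositional using (_∈_)
open import Data.List.Relation.Unary.All using (All)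
open import Data.Product using (Σ; ∃; _×_)
open import Data.Sum using (_⊎_)

-- An update family: a finite family of finite subsets of ℤ ∖ {0},
-- given as a list of lists.
UpdateFamily : Set
UpdateFamily = List (List ℤ)

Stage : UpdateFamily → (ℤ → Set) → ℕ → ℤ → Set
Stage 𝒰 A zero    x = A x
Stage 𝒰 A (suc t) x =
  Stage 𝒰 A t x ⊎ Σ (List ℤ) (λ U → U ∈ 𝒰 × All (λ u → Stage 𝒰 A t (x + u)) U)

Closure : UpdateFamily → (ℤ → Set) → ℤ → Set
Closure 𝒰 A x = ∃ λ t → Stage 𝒰 A t x

ListSet : List ℤ → ℤ → Set
ListSet Z x = x ∈ Z

Finite : (ℤ → Set) → Set
Finite S = ∃ λ (L : List ℤ) → ∀ x → S x → x ∈ L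

family : ℕ → UpdateFamily
family k = ((+ k) ∷ (+ k - + 1) ∷ []) ∷ ((- + k) ∷ (- + k + + 1) ∷ []) ∷ []

module Submission where

-- Pick a residue r mod k that Z avoids and write every point as x = o + (j + q k) with
-- o = r + 1 and 0 ≤ j < k, so that the residue class of r is exactly the top digit
-- j = k − 1.  If x + k − 1, x + k (or x − k, x − k + 1) both have non-top digits, these
-- are consecutive digits j, j + 1 of one block q; then x again has a non-top digit,
-- and its level q + j equals the level of one of the two.  So every infected site has
-- a non-top digit and the level of a point of Z: at most (k − 1) |Z| sites.

open import Defs
open import Data.Integer using (ℤ)
open import Data.Nat using (ℕ; _≤_; _<_)
open import Data.List using (List; length)
open import Data.List.Relation.Unary.Unique.Propositional using (Unique)

open import Algebra.Bundles using (AbelianGroup)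
open import Data.Nat using (zero; suc; NonZero)
open import Data.Nat.Properties using (≤-antisym; <-irrefl; <⇒≤; ≮⇒≥; _<?_)
open import Data.Integer using (-_; +_; +<+; 1ℤ; _+_; _-_; _*_; _%ℕ_; _/ℕ_)
  renaming (_<_ to _<ℤ_; suc to sucℤ)
import Data.Integer.Properties as ℤ
open import Data.Integer.DivMod using (n%ℕd<d; a≡a%ℕn+[a/ℕn]*n)
open import Data.Integer.Tactic.RingSolver using (solve-∀)
open import Data.List using (map; upTo; cartesianProductWith)
open import Data.List.Properties using (length-map)
open import Data.List.Membership.Propositional using (_∈_; _∉_)
open import Data.List.Membership.Propositional.Properties
  using (∈-map⁺; ∈-upTo⁺; ∈-cartesianProductWith⁺)
open import Data.List.Membership.Setoid.Properties using (index-injective)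
open import Data.List.Membership.DecPropositional Data.Nat._≟_ using (_∈?_)
open import Data.List.Relation.Unary.All as All using (All; _∷_; [])
open import Data.List.Relation.Unary.Any using (here; there; index)
open import Data.Fin using (Fin; toℕ)
open import Data.Fin.Properties using (¬∀⟶∃¬; pigeonhole; toℕ<n)
open import Data.Product using (∃; _×_; _,_; proj₁)
open import Data.Sum using (inj₁; inj₂)
open import Data.Empty using (⊥-elim)
open import Relation.Binary.Definitions using (tri<; tri≈; tri>)
open import Relation.Nullary using (¬_; yes; no)
open import Relation.Binary.PropositionalEquality

open import Algebra.Properties.Group (AbelianGroup.group ℤ.+-0-abelianGroup)
  using (∙-cancelˡ; ∙-cancelʳ)

Closed : UpdateFamily → (ℤ → Set) → Set
Closed 𝒰 S = ∀ {x U} → U ∈ 𝒰 → All (λ u → S (x + u)) U → S x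

stage⊆closed : ∀ {𝒰 A S} → Closed 𝒰 S → (∀ {x} → A x → S x) →
               ∀ t {x} → Stage 𝒰 A t x → S x
stage⊆closed closed A⊆S zero    a                      = A⊆S a
stage⊆closed closed A⊆S (suc t) (inj₁ s)               = stage⊆closed closed A⊆S t s
stage⊆closed closed A⊆S (suc t) (inj₂ (_ , U∈𝒰 , all)) =
  closed U∈𝒰 (All.map (stage⊆closed closed A⊆S t) all)

closure⊆closed : ∀ {𝒰 A S} → Closed 𝒰 S → (∀ {x} → A x → S x) →
                 ∀ {x} → Closure 𝒰 A x → S x
closure⊆closed closed A⊆S (t , s) = stage⊆closed closed A⊆S t s

length<⇒∃∉ : ∀ k (R : List ℕ) → length R < k → ∃ λ r → r < k × r ∉ R
length<⇒∃∉ k R |R|<k with ¬∀⟶∃¬ k (λ i → toℕ i ∈ R) (λ i → toℕ i ∈? R) all∈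
  where
  all∈ : ¬ (∀ (i : Fin k) → toℕ i ∈ R)
  all∈ f with pigeonhole |R|<k (λ i → index (f i))
  ... | i , j , i<j , same = <-irrefl (index-injective (setoid ℕ) (f i) (f j) same) i<j
... | i , i∉R = toℕ i , toℕ<n i , i∉R

+j+qk<+j′+q′k : ∀ {k j j′ q q′} → j < k → q <ℤ q′ → + j + q * + k <ℤ + j′ + q′ * + k
+j+qk<+j′+q′k {k} {j} {j′} {q} {q′} j<k q<q′ = begin-strict
  + j + q * + k      <⟨ ℤ.+-monoˡ-< (q * + k) (+<+ j<k) ⟩
  + k + q * + k      ≡⟨ ℤ.suc-* q (+ k) ⟨
  sucℤ q * + k       ≤⟨ ℤ.*-monoʳ-≤-nonNeg (+ k) (ℤ.i<j⇒suc[i]≤j q<q′) ⟩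
  q′ * + k           ≤⟨ ℤ.i≤j+i (q′ * + k) (+ j′) ⟩
  + j′ + q′ * + k    ∎
  where open ℤ.≤-Reasoning

digits-unique : ∀ {k j j′ q q′} → j < k → j′ < k →
                + j + q * + k ≡ + j′ + q′ * + k → j ≡ j′ × q ≡ q′
digits-unique {q = q} {q′} j<k j′<k eq with ℤ.<-cmp q q′
... | tri< q<q′ _ _ = ⊥-elim (ℤ.<-irrefl eq (+j+qk<+j′+q′k j<k q<q′))
... | tri> _ _ q>q′ = ⊥-elim (ℤ.<-irrefl (sym eq) (+j+qk<+j′+q′k j′<k q>q′))
... | tri≈ _ refl _ = ℤ.+-injective (∙-cancelʳ (q * + _) _ _ eq) , refl

i+[j-1]+1≡i+j : ∀ x K → x + (K - 1ℤ) + 1ℤ ≡ x + K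
i+[j-1]+1≡i+j = solve-∀

i≡i+j-j : ∀ i j → i ≡ i + j - j
i≡i+j-j = solve-∀

i≡j+[i-j] : ∀ i j → i ≡ j + (i - j)
i≡j+[i-j] = solve-∀

module Expansions (k : ℕ) (o : ℤ) (Λ : List ℤ) where

  record Expansion (x : ℤ) : Set where
    constructor expansion
    field
      digit : ℕ
      block : ℤ
      digit-not-top : suc digit < k
      x≡ : x ≡ o + (+ digit + block * + k)
      level∈Λ : block + + digit ∈ Λ

  successor-digits : ∀ {y j q j′ q′} → suc j < k → j′ < k →
                     y ≡ o + (+ j + q * + k) → y + 1ℤ ≡ o + (+ j′ + q′ * + k) →
                     suc j ≡ j′ × q ≡ q′
  successor-digits {y} {j} {q} {j′} {q′} sj<k j′<k y≡ y+1≡ =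
    digits-unique sj<k j′<k (∙-cancelˡ o _ _ (begin
      o + (+ suc j + q * + k)  ≡⟨ shift o (+ j) (q * + k) ⟨
      o + (+ j + q * + k) + 1ℤ ≡⟨ cong (_+ 1ℤ) y≡ ⟨
      y + 1ℤ                   ≡⟨ y+1≡ ⟩
      o + (+ j′ + q′ * + k)    ∎))
    where
    open ≡-Reasoning
    shift : ∀ o J B → o + (J + B) + 1ℤ ≡ o + ((1ℤ + J) + B)
    shift = solve-∀

  rule₁ : ∀ {x} → Expansion (x + (+ k - 1ℤ)) → Expansion (x + + k) → Expansion x
  rule₁ {x} (expansion j q sj<k y≡ level∈Λ) (expansion _ q′ ssj<k y+1≡ _)
    with refl , refl ← successor-digits {q = q} {q′ = q′} sj<k (<⇒≤ ssj<k) y≡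
                                         (trans (i+[j-1]+1≡i+j x (+ k)) y+1≡)
    = expansion (suc j) (q - 1ℤ) ssj<k x≡ (subst (_∈ Λ) (same-level q (+ j)) level∈Λ)
    where
    open ≡-Reasoning
    same-level : ∀ q J → q + J ≡ q - 1ℤ + (1ℤ + J)
    same-level = solve-∀
    regroup : ∀ o J q K → o + (J + q * K) - (K - 1ℤ) ≡ o + ((1ℤ + J) + (q - 1ℤ) * K)
    regroup = solve-∀
    x≡ : x ≡ o + (+ suc j + (q - 1ℤ) * + k)
    x≡ = begin
      x                                  ≡⟨ i≡i+j-j x (+ k - 1ℤ) ⟩
      x + (+ k - 1ℤ) - (+ k - 1ℤ)        ≡⟨ cong (_- (+ k - 1ℤ)) y≡ ⟩
      o + (+ j + q * + k) - (+ k - 1ℤ)   ≡⟨ regroup o (+ j) q (+ k) ⟩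
      o + (+ suc j + (q - 1ℤ) * + k)     ∎

  rule₂ : ∀ {x} → Expansion (x + - + k) → Expansion (x + (- + k + 1ℤ)) → Expansion x
  rule₂ {x} (expansion j q sj<k y≡ _) (expansion _ q′ ssj<k y+1≡ level∈Λ)
    with refl , refl ← successor-digits {q = q} {q′ = q′} sj<k (<⇒≤ ssj<k) y≡
                                         (trans (ℤ.+-assoc x (- + k) 1ℤ) y+1≡)
    = expansion j (q + 1ℤ) sj<k x≡ (subst (_∈ Λ) (same-level q (+ j)) level∈Λ)
    where
    open ≡-Reasoning
    same-level : ∀ q J → q + (1ℤ + J) ≡ q + 1ℤ + J
    same-level = solve-∀
    regroup : ∀ o J q K → o + (J + q * K) - - K ≡ o + (J + (q + 1ℤ) * K)
    regroup = solve-∀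
    x≡ : x ≡ o + (+ j + (q + 1ℤ) * + k)
    x≡ = begin
      x                                ≡⟨ i≡i+j-j x (- + k) ⟩
      x + - + k - - + k                ≡⟨ cong (_- - + k) y≡ ⟩
      o + (+ j + q * + k) - - + k      ≡⟨ regroup o (+ j) q (+ k) ⟩
      o + (+ j + (q + 1ℤ) * + k)       ∎

  expansion-closed : Closed (family k) Expansion
  expansion-closed (here refl)         (e ∷ e′ ∷ []) = rule₁ e′ e
  expansion-closed (there (here refl)) (e ∷ e′ ∷ []) = rule₂ e e′

  point : ℤ → ℕ → ℤ
  point ℓ j = o + (+ j + (ℓ - + j) * + k)

  expansion-points : List ℤ
  expansion-points = cartesianProductWith point Λ (upTo k)

  expansion-finite : Finite Expansion
  expansion-finite = expansion-points , λ where
    x (expansion j q sj<k x≡ level∈Λ) →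
      subst (_∈ expansion-points)
            (sym (trans x≡ (cong (λ b → o + (+ j + b * + k)) (i≡i+j-j q (+ j)))))
            (∈-cartesianProductWith⁺ point level∈Λ (∈-upTo⁺ (<⇒≤ sj<k)))

top-digit-residue : ∀ {k r d b z} .{{_ : NonZero k}} → r < k → suc d ≡ k →
                    z ≡ + suc r + (+ d + b * + k) → z %ℕ k ≡ r
top-digit-residue {r = r} {d} {b} {z} r<k refl z≡ =
  sym (proj₁ (digits-unique {q = b + 1ℤ} {q′ = z /ℕ suc d} r<k (n%ℕd<d z (suc d))
  (begin
    + r + (b + 1ℤ) * + suc d                ≡⟨ regroup (+ r) (+ d) b ⟩
    + suc r + (+ d + b * + suc d)           ≡⟨ z≡ ⟨
    z                                       ≡⟨ a≡a%ℕn+[a/ℕn]*n z (suc d) ⟩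
    + (z %ℕ suc d) + (z /ℕ suc d) * + suc d ∎)))
  where
  open ≡-Reasoning
  regroup : ∀ R D b → R + (b + 1ℤ) * (1ℤ + D) ≡ (1ℤ + R) + (D + b * (1ℤ + D))
  regroup = solve-∀

finite-closure : ∀ k .{{_ : NonZero k}} (Z : List ℤ) → length Z < k →
                 Finite (Closure (family k) (ListSet Z))
finite-closure k Z |Z|<k
  with r , r<k , r∉Z%k ← length<⇒∃∉ k (map (_%ℕ k) Z)
                            (subst (_< k) (sym (length-map (_%ℕ k) Z)) |Z|<k)
  = let L , Expansion⊆L = expansion-finite
    in L , λ x x∈[Z] → Expansion⊆L x (closure⊆closed expansion-closed initial x∈[Z])
  where
  o : ℤ
  o = + suc r
  level : ℤ → ℤ
  level z = (z - o) /ℕ k + + ((z - o) %ℕ k)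
  open Expansions k o (map level Z)
  initial : ∀ {z} → z ∈ Z → Expansion z
  initial {z} z∈Z = expansion d b d-not-top z≡ (∈-map⁺ level z∈Z)
    where
    d = (z - o) %ℕ k
    b = (z - o) /ℕ k
    z≡ : z ≡ o + (+ d + b * + k)
    z≡ = trans (i≡j+[i-j] z o) (cong (_+_ o) (a≡a%ℕn+[a/ℕn]*n (z - o) k))
    d-not-top : suc d < k
    d-not-top with suc d <? k
    ... | yes sd<k = sd<k
    ... | no sd≮k = ⊥-elim (r∉Z%k (subst (_∈ map (_%ℕ k) Z)
            (top-digit-residue {b = b} r<k (≤-antisym (n%ℕd<d (z - o) k) (≮⇒≥ sd≮k)) z≡)
            (∈-map⁺ (_%ℕ k) z∈Z)))

lemmaA2 : (k : ℕ) → 2 ≤ k → (Z : List ℤ) → Unique Z → length Z < k →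
          Finite (Closure (family k) (ListSet Z))
lemmaA2 (suc k) _ Z _ = finite-closure (suc k) Z
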